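{- Let $k\geq 1$ and let $G$ be a $(2k+1)$-ordered simple graph on $n\geq 2k+1$ vertices. Then the diameter $d$ of $G$ satisfies $d\leq \left\lfloor \frac{n-3}{2k}\right\rfloor+2$.
   Context: A simple graph $G$ is $r$-ordered if, for every sequence $v_1, \ldots, v_r$ of $r$ distinct vertices of $G$, there exists a cycle in $G$ containing $v_1, \ldots, v_r$ in this (cyclic) order. -}

module Defs where

open import Data.Nat using (ℕ; zero; suc; _+_; _*_; _∸_; _≤_; _<_)
open import Data.Nat.DivMod using (_/_)
open import Data.Fin using (Fin; inject₁; fromℕ) renaming (zero to fzero; suc to fsuc; _<_ to _<ᶠ_)
open import Data.Product using (Σ; _×_; ∃)
open import Relation.Binary.PropositionalEquality using (_≡_)
open import Relation.Nullary using (¬_)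
open import Function.Definitions using (Injective)

record SimpleGraph (n : ℕ) : Set₁ where
  field
    Adj   : Fin n → Fin n → Set
    sym   : ∀ {u v} → Adj u v → Adj v u
    irrefl : ∀ {u} → ¬ Adj u u

open SimpleGraph public

record Cycle {n : ℕ} (G : SimpleGraph n) : Set where
  field
    m       : ℕ
    long    : 2 ≤ m
    vert    : Fin (suc m) → Fin n
    distinct : Injective _≡_ _≡_ vert
    step    : ∀ (i : Fin m) → Adj G (vert (inject₁ i)) (vert (fsuc i))
    close   : Adj G (vert (fromℕ m)) (vert fzero)

open Cycle public

-- Since cycles are
-- given with an arbitrary starting point, it suffices (up to rotation) to ask that
-- they occur at strictly increasing positions.
ContainsInOrder : ∀ {n r} {G : SimpleGraph n} → Cycle G → (Fin r → Fin n) → Set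
ContainsInOrder {r = r} C v =
  Σ (Fin r → Fin (suc (m C))) λ pos →
    (∀ i j → i <ᶠ j → pos i <ᶠ pos j) × (∀ i → vert C (pos i) ≡ v i)

Ordered : ∀ {n} → ℕ → SimpleGraph n → Set
Ordered {n} r G = ∀ (v : Fin r → Fin n) → Injective _≡_ _≡_ v →
  Σ (Cycle G) λ C → ContainsInOrder C v

data Walk {n : ℕ} (G : SimpleGraph n) : Fin n → Fin n → ℕ → Set where
  here : ∀ {u} → Walk G u u 0
  there : ∀ {u v w ℓ} → Adj G u v → Walk G v w ℓ → Walk G u w (suc ℓ)

DistLe : ∀ {n} → SimpleGraph n → Fin n → Fin n → ℕ → Set
DistLe G u w D = ∃ λ ℓ → Walk G u w ℓ × ℓ ≤ D

DiamLe : ∀ {n} → SimpleGraph n → ℕ → Set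
DiamLe G D = ∀ u w → DistLe G u w D

-- ⌊(n-3)/(2k)⌋ + 2, for k ≥ 1 (value at k = 0 is irrelevant).
bound : ℕ → ℕ → ℕ
bound n zero = 0
bound n (suc k) = (n ∸ 3) / (2 * suc k) + 2

{-# OPTIONS --safe #-}
module Submission where

-- Fix distinct vertices u, w and put r = 2k + 1. Every vertex x has a neighbour outside any set Z
-- of at most r − 2 other vertices, so one can greedily choose k − 1 pairs (aᵢ, bᵢ) with u ~ aᵢ and
-- bᵢ ~ w such that u, w, a₁, b₁, …, a_{k−1}, b_{k−1} are 2k distinct vertices. A cycle C through
-- them in this order is cut by them into 2k arcs, and each arc gives a u–w walk: the arc from u to
-- w itself, an arc between consecutive vertices of the list prolonged by the edges u aᵢ and bⱼ w
-- (two more edges), and the arc from b_{k−1} round to u prolonged by b_{k−1} w (one more edge).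
-- The total length of these 2k walks is at most |C| + 4k − 3 ≤ n + 4k − 3, so the shortest one
-- has length at most ⌊(n − 3)/(2k)⌋ + 2.

open import Defs
open import Data.Nat using (ℕ; zero; suc; _+_; _*_; _∸_; _≤_; _<_; z≤n; s≤s; _≤?_; NonZero)
open import Data.Nat.Properties
  using ( ≤-refl; ≤-reflexive; ≤-trans; <⇒≤; <⇒≱; ≰⇒>; n≤1+n; m≤m+n; m≤n+m∸n
        ; +-comm; +-assoc; +-suc; +-identityʳ; *-suc; m∸n+n≡m; m+[n∸m]≡n
        ; +-mono-≤; +-monoˡ-≤; +-monoʳ-≤; +-monoˡ-<; *-monoʳ-≤; +-cancelˡ-≤; +-cancelʳ-≤
        ; module ≤-Reasoning )
open import Data.Nat.DivMod using (_/_; _%_; m≡m%n+[m/n]*n; m%n<n)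
open import Data.Nat.Tactic.RingSolver using (solve-∀)
open import Data.Fin using (Fin; toℕ; inject₁; fromℕ; _≟_) renaming (zero to fzero; suc to fsuc)
open import Data.Fin.Properties using (toℕ-inject₁; toℕ≤pred[n]; toℕ-fromℕ; ≤fromℕ; injective⇒≤; ¬∀⟶∃¬)
open import Data.List using (List; []; _∷_; _++_; length; lookup; map)
open import Data.Nat.ListAction using (sum)
open import Data.List.Membership.Propositional using (_∈_; _∉_)
open import Data.List.Membership.Propositional.Properties using (∈-lookup)
import Data.List.Membership.DecPropositional as DecMembership
open import Data.List.Relation.Unary.All as All using (All; []; _∷_)
open import Data.List.Relation.Unary.All.Properties using (¬Any⇒All¬)
open import Data.List.Relation.Unary.Any using (Any; here; there; index; satisfied)
open import Data.List.Relation.Unary.Any.Properties using (lookup-index)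
open import Data.List.Relation.Unary.Unique.Propositional using (Unique; []; _∷_)
open import Data.Product using (Σ; ∃; _×_; _,_; proj₁)
open import Relation.Nullary using (¬_; yes; no)
open import Data.Empty using (⊥-elim)
open import Relation.Binary.PropositionalEquality
  using (_≡_; _≢_; refl; cong; subst; trans; ≢-sym; module ≡-Reasoning) renaming (sym to ≡-sym)
open import Function using (_∘_)

pigeonhole-sum : ∀ {A : Set} (f : A → ℕ) (xs : List A) {B : ℕ} →
  sum (map f xs) < length xs * suc B → Any (λ x → f x ≤ B) xs
pigeonhole-sum f (x ∷ xs) {B} total<bound with f x ≤? B
... | yes fx≤B = here fx≤B
... | no fx≰B = there (pigeonhole-sum f xs (+-cancelˡ-≤ (suc B) _ _ (begin
  suc B + suc (sum (map f xs))   ≤⟨ +-monoˡ-≤ _ (≰⇒> fx≰B) ⟩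
  f x + suc (sum (map f xs))     ≡⟨ +-suc (f x) _ ⟩
  suc (f x + sum (map f xs))     ≤⟨ total<bound ⟩
  suc B + length xs * suc B      ∎)))
  where open ≤-Reasoning

x<[1+x/c]*c : ∀ x c .{{_ : NonZero c}} → x < suc (x / c) * c
x<[1+x/c]*c x c = begin-strict
  x                    ≡⟨ m≡m%n+[m/n]*n x c ⟩
  x % c + x / c * c    <⟨ +-monoˡ-< _ (m%n<n x c) ⟩
  c + x / c * c        ∎
  where open ≤-Reasoning

mean-bound : ∀ c n s .{{_ : NonZero c}} → s + 3 ≤ n + 2 * c → s < c * suc ((n ∸ 3) / c + 2)
mean-bound c n s s+3≤n+2c = +-cancelʳ-≤ 3 _ _ (begin
  suc s + 3                      ≤⟨ s≤s s+3≤n+2c ⟩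
  suc (n + 2 * c)                ≤⟨ s≤s (+-monoˡ-≤ _ (m≤n+m∸n n 3)) ⟩
  3 + suc (n ∸ 3) + 2 * c        ≤⟨ +-monoˡ-≤ _ (+-monoʳ-≤ 3 (x<[1+x/c]*c (n ∸ 3) c)) ⟩
  3 + suc Q * c + 2 * c          ≡⟨ regroup Q c ⟩
  c * suc (Q + 2) + 3            ∎)
  where
    open ≤-Reasoning
    Q = (n ∸ 3) / c
    regroup : ∀ Q c → 3 + suc Q * c + 2 * c ≡ c * suc (Q + 2) + 3
    regroup = solve-∀

∸-telescope : ∀ {a b c} → a ≤ b → b ≤ c → (b ∸ a) + (c ∸ b) + a ≡ c
∸-telescope {a} {b} {c} a≤b b≤c = begin
  (b ∸ a) + (c ∸ b) + a   ≡⟨ +-assoc (b ∸ a) (c ∸ b) a ⟩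
  (b ∸ a) + ((c ∸ b) + a) ≡⟨ cong ((b ∸ a) +_) (+-comm (c ∸ b) a) ⟩
  (b ∸ a) + (a + (c ∸ b)) ≡⟨ ≡-sym (+-assoc (b ∸ a) a (c ∸ b)) ⟩
  (b ∸ a) + a + (c ∸ b)   ≡⟨ cong (_+ (c ∸ b)) (m∸n+n≡m a≤b) ⟩
  b + (c ∸ b)             ≡⟨ m+[n∸m]≡n b≤c ⟩
  c                       ∎
  where open ≡-Reasoning

-- The two walks through the arcs β–α and α–β′ of a cycle, each with two extra edges.
arc-pair-total : ∀ {β α β′ s l e} → β ≤ α → α ≤ β′ → s + β′ ≤ l + 2 * e →
  (1 + (α ∸ β) + 1) + ((1 + (β′ ∸ α) + 1) + s) + β ≤ l + 2 * (2 + e)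
arc-pair-total {β} {α} {β′} {s} {l} {e} β≤α α≤β′ s+β′≤l+2e = begin
  (1 + x + 1) + ((1 + y + 1) + s) + β    ≡⟨ regroup x y s β ⟩
  4 + (s + (x + y + β))                  ≡⟨ cong (λ t → 4 + (s + t)) (∸-telescope β≤α α≤β′) ⟩
  4 + (s + β′)                           ≤⟨ +-monoʳ-≤ 4 s+β′≤l+2e ⟩
  4 + (l + 2 * e)                        ≡⟨ regroup′ l e ⟩
  l + 2 * (2 + e)                        ∎
  where
    open ≤-Reasoning
    x = α ∸ β
    y = β′ ∸ α
    regroup : ∀ x y s β → (1 + x + 1) + ((1 + y + 1) + s) + β ≡ 4 + (s + (x + y + β))
    regroup = solve-∀
    regroup′ : ∀ l e → 4 + (l + 2 * e) ≡ l + 2 * (2 + e)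
    regroup′ = solve-∀

-- The walk along the arc q₀–q₁ and the one round a cycle of length m + 1 from l back to q₀.
closing-total : ∀ {q₀ q₁ s l e m n c} → q₀ ≤ q₁ → s + q₁ ≤ l + 2 * e → l ≤ m → suc m ≤ n → 2 + e ≡ c →
  (q₁ ∸ q₀) + ((m ∸ l + 1 + q₀ + 1) + s) + 3 ≤ n + 2 * c
closing-total {q₀} {q₁} {s} {l} {e} {m} {n} q₀≤q₁ s+q₁≤l+2e l≤m m<n refl = begin
  (q₁ ∸ q₀) + ((m ∸ l + 1 + q₀ + 1) + s) + 3   ≡⟨ regroup (m ∸ l) q₀ (q₁ ∸ q₀) s ⟩
  (m ∸ l) + (s + ((q₁ ∸ q₀) + q₀)) + 5         ≡⟨ cong (λ t → (m ∸ l) + (s + t) + 5) (m∸n+n≡m q₀≤q₁) ⟩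
  (m ∸ l) + (s + q₁) + 5                       ≤⟨ +-monoˡ-≤ 5 (+-monoʳ-≤ (m ∸ l) s+q₁≤l+2e) ⟩
  (m ∸ l) + (l + 2 * e) + 5                    ≡⟨ regroup′ (m ∸ l) l e ⟩
  suc ((m ∸ l) + l) + (2 * e + 4)              ≡⟨ cong (λ t → suc t + (2 * e + 4)) (m∸n+n≡m l≤m) ⟩
  suc m + (2 * e + 4)                          ≤⟨ +-monoˡ-≤ _ m<n ⟩
  n + (2 * e + 4)                              ≡⟨ cong (n +_) (regroup″ e) ⟩
  n + 2 * (2 + e)                              ∎
  where
    open ≤-Reasoning
    regroup : ∀ a q d s → d + ((a + 1 + q + 1) + s) + 3 ≡ a + (s + (d + q)) + 5
    regroup = solve-∀
    regroup′ : ∀ a l e → a + (l + 2 * e) + 5 ≡ suc (a + l) + (2 * e + 4)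
    regroup′ = solve-∀
    regroup″ : ∀ e → 2 * e + 4 ≡ 2 * (2 + e)
    regroup″ = solve-∀

room-for-two-more : ∀ {l i r} → l ≡ 2 * suc i → 2 * suc (suc i) ≤ r → 2 + l ≤ r
room-for-two-more {i = i} {r} refl = subst (_≤ r) (*-suc 2 (suc i))

lookup-injective : ∀ {A : Set} {xs : List A} → Unique xs → ∀ {i j} → lookup xs i ≡ lookup xs j → i ≡ j
lookup-injective (_ ∷ _)      {fzero}  {fzero}  _     = refl
lookup-injective (x≢xs ∷ _)   {fzero}  {fsuc j} x≡xⱼ  = ⊥-elim (All.lookup x≢xs (∈-lookup j) x≡xⱼ)
lookup-injective (x≢xs ∷ _)   {fsuc i} {fzero}  xᵢ≡x  = ⊥-elim (All.lookup x≢xs (∈-lookup i) (≡-sym xᵢ≡x))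
lookup-injective (_ ∷ unique) {fsuc i} {fsuc j} xᵢ≡xⱼ = cong fsuc (lookup-injective unique xᵢ≡xⱼ)

fresh : ∀ {n} (xs : List (Fin n)) → length xs < n → ∃ λ y → y ∉ xs
fresh {n} xs length<n = ¬∀⟶∃¬ n (_∈ xs) (_∈? xs) not-all
  where
    open DecMembership _≟_ using (_∈?_)
    not-all : ¬ (∀ y → y ∈ xs)
    not-all all = <⇒≱ length<n (injective⇒≤ index-injective)
      where
        index-injective : ∀ {y y′} → index (all y) ≡ index (all y′) → y ≡ y′
        index-injective {y} {y′} eq =
          trans (lookup-index (all y)) (trans (cong (lookup xs) eq) (≡-sym (lookup-index (all y′))))

extend : ∀ {n} (d : ℕ) {zs : List (Fin n)} → Unique zs → d + length zs ≤ n →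
  ∃ λ F → length (F ++ zs) ≡ d + length zs × Unique (F ++ zs)
extend zero unique _ = [] , refl , unique
extend (suc d) {zs} unique d+1+len≤n with extend d unique (≤-trans (n≤1+n _) d+1+len≤n)
... | F , len , uniqueF with fresh (F ++ zs) (subst (_< _) (≡-sym len) d+1+len≤n)
... | y , y∉ = y ∷ F , cong suc len , ¬Any⇒All¬ _ y∉ ∷ uniqueF

module _ {n : ℕ} {G : SimpleGraph n} where

  _++ʷ_ : ∀ {u v w a b} → Walk G u v a → Walk G v w b → Walk G u w (a + b)
  here      ++ʷ q = q
  there e p ++ʷ q = there e (p ++ʷ q)

  reverseʷ : ∀ {u v a} → Walk G u v a → Walk G v u a
  reverseʷ here = here
  reverseʷ {a = suc a} (there e p) =
    subst (Walk G _ _) (+-comm a 1) (reverseʷ p ++ʷ there (sym G e) here)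

  DistLe-refl : ∀ {u} → DistLe G u u 0
  DistLe-refl = 0 , here , z≤n

  DistLe-edge : ∀ {u v} → Adj G u v → DistLe G u v 1
  DistLe-edge e = 1 , there e here , ≤-refl

  DistLe-trans : ∀ {u v w a b} → DistLe G u v a → DistLe G v w b → DistLe G u w (a + b)
  DistLe-trans (ℓ , p , ℓ≤a) (ℓ′ , q , ℓ′≤b) = ℓ + ℓ′ , p ++ʷ q , +-mono-≤ ℓ≤a ℓ′≤b

  DistLe-sym : ∀ {u v a} → DistLe G u v a → DistLe G v u a
  DistLe-sym (ℓ , p , ℓ≤a) = ℓ , reverseʷ p , ℓ≤a

  DistLe-weaken : ∀ {u v a b} → a ≤ b → DistLe G u v a → DistLe G u v b
  DistLe-weaken a≤b (ℓ , p , ℓ≤a) = ℓ , p , ≤-trans ℓ≤a a≤b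

  DistLe-from-total : ∀ {u w B} (ws : List (∃ (DistLe G u w))) →
    sum (map proj₁ ws) < length ws * suc B → DistLe G u w B
  DistLe-from-total ws total<bound
    with (ℓ , u⇝w) , ℓ≤B ← satisfied (pigeonhole-sum proj₁ ws total<bound)
    = DistLe-weaken ℓ≤B u⇝w

adj⇒≢ : ∀ {n} (G : SimpleGraph n) {x y} → Adj G x y → x ≢ y
adj⇒≢ G x~y refl = irrefl G x~y

IsWalk : ∀ {n ℓ} → SimpleGraph n → (Fin (suc ℓ) → Fin n) → Set
IsWalk {ℓ = ℓ} G vt = (i : Fin ℓ) → Adj G (vt (inject₁ i)) (vt (fsuc i))

module _ {n : ℕ} {G : SimpleGraph n} where

  segment : ∀ {ℓ} {vt : Fin (suc ℓ) → Fin n} → IsWalk G vt →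
    (p q : Fin (suc ℓ)) → toℕ p ≤ toℕ q → DistLe G (vt p) (vt q) (toℕ q ∸ toℕ p)
  segment steps fzero fzero _ = DistLe-refl
  segment {suc ℓ} steps fzero (fsuc q) _ =
    DistLe-trans (DistLe-edge (steps fzero)) (segment (steps ∘ fsuc) fzero q z≤n)
  segment {suc ℓ} steps (fsuc p) (fsuc q) (s≤s p≤q) = segment (steps ∘ fsuc) p q p≤q

  arc : (C : Cycle G) {x y : Fin n} (p q : Fin (suc (m C))) → toℕ p ≤ toℕ q →
    vert C p ≡ x → vert C q ≡ y → DistLe G x y (toℕ q ∸ toℕ p)
  arc C p q p≤q refl refl = segment (step C) p q p≤q

  wrap-arc : (C : Cycle G) {x y : Fin n} (p q : Fin (suc (m C))) →
    vert C p ≡ x → vert C q ≡ y → DistLe G y x (m C ∸ toℕ q + 1 + toℕ p)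
  wrap-arc C p q refl refl =
    DistLe-trans (DistLe-trans to-last (DistLe-edge (close C))) (arc C fzero p z≤n refl refl)
    where
      to-last : DistLe G (vert C q) (vert C (fromℕ (m C))) (m C ∸ toℕ q)
      to-last = subst (λ t → DistLe G (vert C q) (vert C (fromℕ (m C))) (t ∸ toℕ q)) (toℕ-fromℕ (m C))
                      (arc C q (fromℕ (m C)) (≤fromℕ q) refl refl)

  data InOrderFrom (C : Cycle G) : ℕ → List (Fin n) → Set where
    [] : ∀ {lo} → InOrderFrom C lo []
    at : ∀ {lo x xs} (p : Fin (suc (m C))) → lo ≤ toℕ p → vert C p ≡ x →
         InOrderFrom C (suc (toℕ p)) xs → InOrderFrom C lo (x ∷ xs)

  module _ (C : Cycle G) where

    InOrderFrom-++⁻ʳ : ∀ F {lo xs} → InOrderFrom C lo (F ++ xs) → ∃ λ lo′ → InOrderFrom C lo′ xs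
    InOrderFrom-++⁻ʳ []      onxs                = _ , onxs
    InOrderFrom-++⁻ʳ (_ ∷ F) (at _ _ _ onF++xs) = InOrderFrom-++⁻ʳ F onF++xs

    InOrderFrom-∈ : ∀ {lo xs z} → InOrderFrom C lo xs → z ∈ xs → ∃ λ p → vert C p ≡ z × lo ≤ toℕ p
    InOrderFrom-∈ (at p lo≤p refl _) (here refl) = p , refl , lo≤p
    InOrderFrom-∈ (at p lo≤p _ onxs) (there z∈xs) with InOrderFrom-∈ onxs z∈xs
    ... | q , q-at , p<q = q , q-at , ≤-trans lo≤p (<⇒≤ p<q)

    positions⇒InOrderFrom : (zs : List (Fin n)) (pos : Fin (length zs) → Fin (suc (m C))) →
      (∀ i j → toℕ i < toℕ j → toℕ (pos i) < toℕ (pos j)) → (∀ i → vert C (pos i) ≡ lookup zs i) →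
      ∀ {lo} → (∀ i → lo ≤ toℕ (pos i)) → InOrderFrom C lo zs
    positions⇒InOrderFrom [] _ _ _ _ = []
    positions⇒InOrderFrom (z ∷ zs) pos increasing hits lo≤pos =
      at (pos fzero) (lo≤pos fzero) (hits fzero)
        (positions⇒InOrderFrom zs (pos ∘ fsuc) (λ i j → increasing (fsuc i) (fsuc j) ∘ s≤s) (hits ∘ fsuc)
          (λ i → increasing fzero (fsuc i) (s≤s z≤n)))

data NeighbourPair {n} (G : SimpleGraph n) (u w : Fin n) : Set where
  ⟨_,_⟩ : ∀ {a b} → Adj G u a → Adj G b w → NeighbourPair G u w

ends : ∀ {n} {G : SimpleGraph n} {u w} → List (NeighbourPair G u w) → List (Fin n)
ends [] = []
ends (⟨_,_⟩ {a} {b} _ _ ∷ P) = a ∷ b ∷ ends P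

-- u–w walks through the arcs of C between positions β and last, each at most two edges longer
-- than its arc.
record ArcWalks {n} {G : SimpleGraph n} (u w : Fin n) (C : Cycle G) (β : Fin (suc (m C))) (e : ℕ) : Set where
  field
    walks  : List (∃ (DistLe G u w))
    count  : length walks ≡ e
    last   : Fin (suc (m C))
    last~w : DistLe G (vert C last) w 1
    total  : sum (map proj₁ walks) + toℕ β ≤ toℕ last + 2 * e

arc-walks : ∀ {n} {G : SimpleGraph n} {u w} (C : Cycle G) (P : List (NeighbourPair G u w))
  (β : Fin (suc (m C))) → DistLe G (vert C β) w 1 → InOrderFrom C (suc (toℕ β)) (ends P) →
  ArcWalks u w C β (length (ends P))
arc-walks C [] β β~w [] = record
  { walks = [] ; count = refl ; last = β ; last~w = β~w
  ; total = ≤-reflexive (≡-sym (+-identityʳ (toℕ β))) }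
arc-walks {G = G} {u} {w} C (⟨ u~a , b~w ⟩ ∷ P) β β~w (at α β<α a-at (at β′ α<β′ b-at onP)) = record
  { walks  = (_ , back) ∷ (_ , forth) ∷ walks
  ; count  = cong (2 +_) count
  ; last   = last
  ; last~w = last~w
  ; total  = arc-pair-total (<⇒≤ β<α) (<⇒≤ α<β′) total }
  where
    open ArcWalks (arc-walks C P β′ (DistLe-edge (subst (λ v → Adj G v w) (≡-sym b-at) b~w)) onP)
    back : DistLe G u w (1 + (toℕ α ∸ toℕ β) + 1)
    back = DistLe-trans (DistLe-trans (DistLe-edge u~a) (DistLe-sym (arc C β α (<⇒≤ β<α) refl a-at))) β~w
    forth : DistLe G u w (1 + (toℕ β′ ∸ toℕ α) + 1)
    forth = DistLe-trans (DistLe-trans (DistLe-edge u~a) (arc C α β′ (<⇒≤ α<β′) a-at b-at)) (DistLe-edge b~w)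

inOrder-cycle : ∀ {n} {G : SimpleGraph n} {zs : List (Fin n)} → Ordered (length zs) G → Unique zs →
  Σ (Cycle G) λ C → InOrderFrom C 0 zs
inOrder-cycle {zs = zs} ordered unique with ordered (lookup zs) (lookup-injective unique)
... | C , pos , increasing , hits = C , positions⇒InOrderFrom C zs pos increasing hits (λ _ → z≤n)

module _ {n r : ℕ} {G : SimpleGraph n} (ordered : Ordered r G) (r≤n : r ≤ n) where

  cycle-through : ∀ {zs : List (Fin n)} → Unique zs → length zs ≤ r →
    Σ (Cycle G) λ C → ∃ λ lo → InOrderFrom C lo zs
  cycle-through {zs} unique len≤r
    with F , len , uniqueF ← extend (r ∸ length zs) unique (subst (_≤ n) (≡-sym (m∸n+n≡m len≤r)) r≤n)
    with C , onF++zs ←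
      inOrder-cycle (subst (λ l → Ordered l G) (≡-sym (trans len (m∸n+n≡m len≤r))) ordered) uniqueF
    = C , InOrderFrom-++⁻ʳ C F onF++zs

  -- On a cycle through f, x, Z (in this order) the predecessor of x lies strictly before Z.
  fresh-neighbour : ∀ {x Z} → Unique (x ∷ Z) → 2 + length Z ≤ r → ∃ λ y → Adj G x y × All (y ≢_) Z
  fresh-neighbour {x} {Z} unique 2+len≤r with fresh (x ∷ Z) (≤-trans 2+len≤r r≤n)
  ... | f , f∉x∷Z with cycle-through (¬Any⇒All¬ _ f∉x∷Z ∷ unique) 2+len≤r
  ... | C , _ , at _ _ _ (at fzero () _ _)
  ... | C , _ , at _ _ _ (at (fsuc q) _ x-at onZ) =
    vert C (inject₁ q) , sym G (subst (Adj G _) x-at (step C q)) , ¬Any⇒All¬ Z y∉Z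
    where
      y∉Z : vert C (inject₁ q) ∉ Z
      y∉Z y∈Z with p , p-at , q+1<p ← InOrderFrom-∈ C onZ y∈Z
        rewrite distinct C p-at | toℕ-inject₁ q = <⇒≱ q+1<p (n≤1+n _)

  neighbour-pairs : ∀ {u w} → u ≢ w → (i : ℕ) → 2 * suc i ≤ r →
    Σ (List (NeighbourPair G u w)) λ P → length (u ∷ w ∷ ends P) ≡ 2 * suc i × Unique (u ∷ w ∷ ends P)
  neighbour-pairs u≢w zero _ = [] , refl , (u≢w ∷ []) ∷ [] ∷ []
  neighbour-pairs {u} {w} u≢w (suc i) 2[i+2]≤r
    with P , len , (_ ∷ u≢P) ∷ (w≢P ∷ uniqueP) ←
      neighbour-pairs u≢w i (≤-trans (*-monoʳ-≤ 2 (n≤1+n (suc i))) 2[i+2]≤r)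
    with a , u~a , a≢w ∷ a≢P ←
      fresh-neighbour ((u≢w ∷ u≢P) ∷ (w≢P ∷ uniqueP)) (≤-trans (n≤1+n _) (room-for-two-more len 2[i+2]≤r))
    with b , w~b , b≢u ∷ b≢a ∷ b≢P ←
      fresh-neighbour ((≢-sym u≢w ∷ ≢-sym a≢w ∷ w≢P) ∷ (adj⇒≢ G u~a ∷ u≢P) ∷ (a≢P ∷ uniqueP))
        (room-for-two-more len 2[i+2]≤r)
    = ⟨ u~a , sym G w~b ⟩ ∷ P
    , trans (cong (2 +_) len) (≡-sym (*-suc 2 (suc i)))
    , (u≢w ∷ adj⇒≢ G u~a ∷ ≢-sym b≢u ∷ u≢P)
      ∷ (≢-sym a≢w ∷ adj⇒≢ G w~b ∷ w≢P)
      ∷ (≢-sym b≢a ∷ a≢P)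
      ∷ (b≢P ∷ uniqueP)

  walk-family : ∀ {u w} → u ≢ w → (i : ℕ) → 2 * suc i ≤ r →
    Σ (List (∃ (DistLe G u w))) λ ws →
      length ws ≡ 2 * suc i × sum (map proj₁ ws) + 3 ≤ n + 2 * (2 * suc i)
  walk-family {u} {w} u≢w i 2[i+1]≤r
    with P , len , unique ← neighbour-pairs u≢w i 2[i+1]≤r
    with C , _ , at q₀ _ u-at (at q₁ q₀<q₁ w-at onP) ←
      cycle-through unique (subst (_≤ r) (≡-sym len) 2[i+1]≤r)
    = (_ , direct) ∷ (_ , around) ∷ walks
    , trans (cong (2 +_) count) len
    , closing-total (<⇒≤ q₀<q₁) total (toℕ≤pred[n] last) (injective⇒≤ (distinct C)) len
    where
      w-near-w : DistLe G (vert C q₁) w 1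
      w-near-w = DistLe-weaken z≤n (subst (λ v → DistLe G v w 0) (≡-sym w-at) DistLe-refl)
      open ArcWalks (arc-walks C P q₁ w-near-w onP)
      direct : DistLe G u w (toℕ q₁ ∸ toℕ q₀)
      direct = arc C q₀ q₁ (<⇒≤ q₀<q₁) u-at w-at
      around : DistLe G u w (m C ∸ toℕ last + 1 + toℕ q₀ + 1)
      around = DistLe-trans (DistLe-sym (wrap-arc C q₀ last u-at refl)) last~w

corollary3p2 : (k n : ℕ) → 1 ≤ k → 2 * k + 1 ≤ n → (G : SimpleGraph n) →
    Ordered (2 * k + 1) G → DiamLe G (bound n k)
corollary3p2 zero n () _ _ _
corollary3p2 (suc k) n _ r≤n G ordered u w with u ≟ w
... | yes refl = DistLe-weaken z≤n DistLe-refl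
... | no u≢w with ws , count , total ← walk-family ordered r≤n u≢w k (m≤m+n (2 * suc k) 1) =
  DistLe-from-total ws (subst (λ c → sum (map proj₁ ws) < c * suc (bound n (suc k))) (≡-sym count)
                              (mean-bound (2 * suc k) n _ total))
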